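{- (Weak diamond.) For all term distributions $\vec t,\vec t_1',\vec t_2'$, if $\vec t\succ\vec t_1'$ and $\vec t\succ\vec t_2'$, then at least one of the following holds: $\vec t_1'\equiv\vec t_2'$; or $\vec t_1'\succ\vec t_2'$ or $\vec t_2'\succ\vec t_1'$; or there is $\vec t''$ with $\vec t_1'\succ\vec t''$ and $\vec t_2'\succ\vec t''$.
   Context: Calculus. Fix a denumerable set of variables. Pure values: $v,w::=x\mid\lambda x.\vec s\mid *\mid(v_1,v_2)\mid\mathrm{inl}(v)\mid\mathrm{inr}(v)$. Pure terms: $s,t::=v\mid s\,t\mid t;\vec s\mid \mathrm{let}\,(x_1,x_2)=t\,\mathrm{in}\,\vec s\mid\mathrm{match}\,t\,\{\mathrm{inl}(x_1)\mapsto\vec s_1\mid\mathrm{inr}(x_2)\mapsto\vec s_2\}$. Term distributions: $\vec s,\vec t::=\vec 0\mid t\mid\vec s+\vec t\mid\alpha\cdot\vec t$ ($\alpha\in\mathbb C$). Terms up to $\alpha$-conversion; top-level distributions modulo the congruence $\equiv$ generated by: $+$ associative, commutative with neutral $\vec0$; $1\cdot\vec t\equiv\vec t$; $\alpha\cdot(\beta\cdot\vec t)\equiv\alpha\beta\cdot\vec t$; $(\alpha+\beta)\cdot\vec t\equiv\alpha\cdot\vec t+\beta\cdot\vec t$; $\alpha\cdot(\vec t_1+\vec t_2)\equiv\alpha\cdot\vec t_1+\alpha\cdot\vec t_2$. The congruence does not go inside pure terms, and $0\cdot t\not\equiv\vec0$. Constructs extended by linearity: pairs and application bilinear, inl/inr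 linear, sequence/let/match linear in the destructed argument. $\vec t[x:=w]$ is capture-avoiding substitution of a pure value $w$. Atomic evaluation $t\triangleright\vec t'$ is generated by $(\lambda x.\vec t)\,v\triangleright\vec t[x:=v]$; $*;\vec s\triangleright\vec s$; $\mathrm{let}\,(x,y)=(v,w)\,\mathrm{in}\,\vec s\triangleright\vec s[x:=v,y:=w]$; match on $\mathrm{inl}(v)$ gives $\vec s_1[x_1:=v]$, on $\mathrm{inr}(v)$ gives $\vec s_2[x_2:=v]$ ($v,w$ pure values); and, if $t\triangleright\vec t'$: $s\,t\triangleright s\,\vec t'$, $t\,v\triangleright\vec t'\,v$, $t;\vec s\triangleright\vec t';\vec s$, and the same in the destructed position of let and match. One-step evaluation: $\vec t\succ\vec t'$ iff there are $\alpha\in\mathbb C$, a pure term $s$ and distributions $\vec s',\vec r$ with $\vec t\equiv\alpha\cdot s+\vec r$, $\vec t'\equiv\alpha\cdot\vec s'+\vec r$ and $s\triangleright\vec s'$ (here $s$ may occur in $\vec r$). -}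

module Defs where

open import Level using (_⊔_)
open import Algebra.Bundles using (CommutativeRing)
open import Data.Nat using (ℕ; zero; suc)
open import Data.Product using (Σ; ∃; ∃-syntax; _×_; _,_)

-- The calculus, parameterised by the ring of scalars (ℂ in the paper).
-- Variables are de Bruijn indices (terms up to α-conversion).
module Calculus {c ℓ} (R : CommutativeRing c ℓ) where

  open CommutativeRing R using () renaming (Carrier to Scalar; _+_ to _+ₛ_; _*_ to _*ₛ_; _≈_ to _≈ₛ_; 1# to 1ₛ)

  infixl 6 _⊕_
  infixr 7 _·_

  mutual
    data Val : Set c where
      var  : ℕ → Val
      lam  : Dist → Val            -- λx. s⃗  (binds index 0 in the body)
      unit : Val
      pair : Val → Val → Val
      inl  : Val → Val
      inr  : Val → Val

    data Tm : Set c where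
      val   : Val → Tm
      app   : Tm → Tm → Tm
      seq   : Tm → Dist → Tm
      letp  : Tm → Dist → Tm               -- let (x₁,x₂) = t in s⃗ ; x₁ = index 1, x₂ = index 0
      match : Tm → Dist → Dist → Tm        -- match t {inl(x₁) ↦ s⃗₁ | inr(x₂) ↦ s⃗₂}; each binds index 0

    -- term distributions (raw syntax; quotiented by _≡ᵈ_ at top level only)
    data Dist : Set c where
      𝟎   : Dist
      ⌜_⌝ : Tm → Dist
      _⊕_ : Dist → Dist → Dist
      _·_ : Scalar → Dist → Dist

  ext : (ℕ → ℕ) → ℕ → ℕ
  ext ρ zero    = zero
  ext ρ (suc n) = suc (ρ n)

  mutual
    renV : (ℕ → ℕ) → Val → Val
    renV ρ (var x)    = var (ρ x)
    renV ρ (lam b)    = lam (renD (ext ρ) b)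
    renV ρ unit       = unit
    renV ρ (pair v w) = pair (renV ρ v) (renV ρ w)
    renV ρ (inl v)    = inl (renV ρ v)
    renV ρ (inr v)    = inr (renV ρ v)

    renT : (ℕ → ℕ) → Tm → Tm
    renT ρ (val v)         = val (renV ρ v)
    renT ρ (app s t)       = app (renT ρ s) (renT ρ t)
    renT ρ (seq t s)       = seq (renT ρ t) (renD ρ s)
    renT ρ (letp t s)      = letp (renT ρ t) (renD (ext (ext ρ)) s)
    renT ρ (match t s₁ s₂) = match (renT ρ t) (renD (ext ρ) s₁) (renD (ext ρ) s₂)

    renD : (ℕ → ℕ) → Dist → Dist
    renD ρ 𝟎       = 𝟎
    renD ρ ⌜ t ⌝   = ⌜ renT ρ t ⌝
    renD ρ (s ⊕ t) = renD ρ s ⊕ renD ρ t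
    renD ρ (α · t) = α · renD ρ t

  exts : (ℕ → Val) → ℕ → Val
  exts σ zero    = var zero
  exts σ (suc n) = renV suc (σ n)

  mutual
    subV : (ℕ → Val) → Val → Val
    subV σ (var x)    = σ x
    subV σ (lam b)    = lam (subD (exts σ) b)
    subV σ unit       = unit
    subV σ (pair v w) = pair (subV σ v) (subV σ w)
    subV σ (inl v)    = inl (subV σ v)
    subV σ (inr v)    = inr (subV σ v)

    subT : (ℕ → Val) → Tm → Tm
    subT σ (val v)         = val (subV σ v)
    subT σ (app s t)       = app (subT σ s) (subT σ t)
    subT σ (seq t s)       = seq (subT σ t) (subD σ s)
    subT σ (letp t s)      = letp (subT σ t) (subD (exts (exts σ)) s)
    subT σ (match t s₁ s₂) = match (subT σ t) (subD (exts σ) s₁) (subD (exts σ) s₂)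

    subD : (ℕ → Val) → Dist → Dist
    subD σ 𝟎       = 𝟎
    subD σ ⌜ t ⌝   = ⌜ subT σ t ⌝
    subD σ (s ⊕ t) = subD σ s ⊕ subD σ t
    subD σ (α · t) = α · subD σ t

  σ₁ : Val → ℕ → Val
  σ₁ v zero    = v
  σ₁ v (suc n) = var n

  σ₂ : Val → Val → ℕ → Val
  σ₂ v w zero          = w
  σ₂ v w (suc zero)    = v
  σ₂ v w (suc (suc n)) = var n

  _[_] : Dist → Val → Dist
  s [ v ] = subD (σ₁ v) s

  _[_∣_] : Dist → Val → Val → Dist
  s [ v ∣ w ] = subD (σ₂ v w) s

  lin : (Tm → Tm) → Dist → Dist
  lin f 𝟎       = 𝟎
  lin f ⌜ t ⌝   = ⌜ f t ⌝
  lin f (s ⊕ t) = lin f s ⊕ lin f t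
  lin f (α · t) = α · lin f t

  infix 4 _≡ᵈ_
  data _≡ᵈ_ : Dist → Dist → Set (c ⊔ ℓ) where
    ≡-refl  : ∀ {s} → s ≡ᵈ s
    ≡-sym   : ∀ {s t} → s ≡ᵈ t → t ≡ᵈ s
    ≡-trans : ∀ {s t u} → s ≡ᵈ t → t ≡ᵈ u → s ≡ᵈ u
    ≡-⊕     : ∀ {s s' t t'} → s ≡ᵈ s' → t ≡ᵈ t' → s ⊕ t ≡ᵈ s' ⊕ t'
    ≡-·     : ∀ {α β s t} → α ≈ₛ β → s ≡ᵈ t → α · s ≡ᵈ β · t
    ⊕-assoc : ∀ {s t u} → (s ⊕ t) ⊕ u ≡ᵈ s ⊕ (t ⊕ u)
    ⊕-comm  : ∀ {s t} → s ⊕ t ≡ᵈ t ⊕ s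
    ⊕-unit  : ∀ {t} → 𝟎 ⊕ t ≡ᵈ t
    ·-one   : ∀ {t} → 1ₛ · t ≡ᵈ t
    ·-assoc : ∀ {α β t} → α · (β · t) ≡ᵈ (α *ₛ β) · t
    ·-distʳ : ∀ {α β t} → (α +ₛ β) · t ≡ᵈ α · t ⊕ β · t
    ·-distˡ : ∀ {α s t} → α · (s ⊕ t) ≡ᵈ α · s ⊕ α · t

  infix 4 _▷_
  data _▷_ : Tm → Dist → Set c where
    β-lam   : ∀ {b v} → app (val (lam b)) (val v) ▷ b [ v ]
    β-seq   : ∀ {s} → seq (val unit) s ▷ s
    β-let   : ∀ {v w s} → letp (val (pair v w)) s ▷ s [ v ∣ w ]
    β-inl   : ∀ {v s₁ s₂} → match (val (inl v)) s₁ s₂ ▷ s₁ [ v ]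
    β-inr   : ∀ {v s₁ s₂} → match (val (inr v)) s₁ s₂ ▷ s₂ [ v ]
    ξ-appR  : ∀ {s t t'} → t ▷ t' → app s t ▷ lin (app s) t'
    ξ-appL  : ∀ {t t' v} → t ▷ t' → app t (val v) ▷ lin (λ u → app u (val v)) t'
    ξ-seq   : ∀ {t t' s} → t ▷ t' → seq t s ▷ lin (λ u → seq u s) t'
    ξ-let   : ∀ {t t' s} → t ▷ t' → letp t s ▷ lin (λ u → letp u s) t'
    ξ-match : ∀ {t t' s₁ s₂} → t ▷ t' → match t s₁ s₂ ▷ lin (λ u → match u s₁ s₂) t'

  infix 4 _≻_
  _≻_ : Dist → Dist → Set (c ⊔ ℓ)
  t ≻ t' = ∃[ α ] ∃[ s ] ∃[ s' ] ∃[ r ]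
             (t ≡ᵈ α · ⌜ s ⌝ ⊕ r) × (t' ≡ᵈ α · s' ⊕ r) × (s ▷ s')

module Submission where

-- Flatten t ≡ᵈ α·s ⊕ r ≡ᵈ β·u ⊕ q into lists of monomials: ≡ᵈ is then generated by
-- swapping, rescaling, splitting and merging monomials. Label the monomials and carry the
-- labels along these moves, merged monomials sharing a label; every label then has the same
-- total weight on both sides. If the redexes s and u carry the same label, they are the same
-- term, so by determinism of ▷ the two steps reduce parts of one group, and the results differ
-- only in how much of it was reduced. Otherwise r contains a group of u's of total weight β
-- plus that of the u's in q, and q a group of s's of weight α plus that of the s's in r; so
-- each side can also perform the other's step, and both reach the same distribution.

open import Algebra.Bundles using (CommutativeRing)
open import Data.Bool using (Bool; true; false; not; _∨_; _∧_; if_then_else_)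
open import Data.Bool.ListAction using (any)
open import Data.Bool.Properties using (T-≡)
open import Data.List using (List; []; _∷_; _++_; [_]; map; length)
open import Data.List.Properties using (++-assoc; ++-identityʳ; map-++; map-∘; map-id)
open import Data.List.Relation.Unary.All as All using (All; []; _∷_)
open import Data.Nat using (ℕ; zero; suc; _≤_; z≤n; s≤s; _≟_; _≡ᵇ_)
open import Data.Nat.Properties using (≤-refl; ≤-trans; m≤n⇒m≤1+n; ≡ᵇ⇒≡)
open import Data.Product using (∃-syntax; ∃₂; _×_; _,_; proj₁; proj₂; map₁)
open import Data.Sum using (_⊎_; inj₁; inj₂)
open import Function using (_∘_)
open import Function.Bundles using (Equivalence)
open import Level using (_⊔_)
open import Relation.Binary.Bundles using (Setoid)
open import Relation.Binary.Construct.Closure.ReflexiveTransitive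
  using (Star; ε; _◅_; _◅◅_; gmap; kleisliStar; reverse; foldl)
open import Relation.Binary.PropositionalEquality using (_≡_; _≢_; refl; sym; trans; cong; subst; subst₂)
import Relation.Binary.Reasoning.Setoid as SetoidReasoning
open import Relation.Nullary using (yes; no)
open import Relation.Nullary.Decidable using (dec-true; dec-false)
open import Defs

module WeakDiamond {c ℓ} (R : CommutativeRing c ℓ) where
  open Calculus R
  open CommutativeRing R
    using ( _+_; _*_; _≈_; 0#; 1#; -_; +-comm; +-assoc; +-congˡ; +-congʳ; +-identityʳ; -‿inverseʳ
          ; *-congˡ; *-congʳ; *-identityˡ; *-identityʳ; *-assoc; distribˡ; distribʳ; +-commutativeSemigroup)
    renaming (Carrier to Scalar; refl to ≈-refl; sym to ≈-sym; trans to ≈-trans; reflexive to ≈-reflexive)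
  open import Algebra.Properties.CommutativeSemigroup +-commutativeSemigroup using (x∙yz≈y∙xz)

  ≡ᵈ-setoid : Setoid c (c ⊔ ℓ)
  ≡ᵈ-setoid = record
    { Carrier = Dist ; _≈_ = _≡ᵈ_
    ; isEquivalence = record { refl = ≡-refl ; sym = ≡-sym ; trans = ≡-trans } }

  module ≡ᵈ-Reasoning = SetoidReasoning ≡ᵈ-setoid

  infixr 2 _∙_
  _∙_ : ∀ {s t u} → s ≡ᵈ t → t ≡ᵈ u → s ≡ᵈ u
  _∙_ = ≡-trans

  ⊕-congˡ : ∀ {s t t'} → t ≡ᵈ t' → s ⊕ t ≡ᵈ s ⊕ t'
  ⊕-congˡ = ≡-⊕ ≡-refl

  ⊕-congʳ : ∀ {s s' t} → s ≡ᵈ s' → s ⊕ t ≡ᵈ s' ⊕ t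
  ⊕-congʳ e = ≡-⊕ e ≡-refl

  ⊕-identityʳ : ∀ {t} → t ⊕ 𝟎 ≡ᵈ t
  ⊕-identityʳ = ⊕-comm ∙ ⊕-unit

  ⊕-lcomm : ∀ {s t u} → s ⊕ (t ⊕ u) ≡ᵈ t ⊕ (s ⊕ u)
  ⊕-lcomm = ≡-sym ⊕-assoc ∙ ⊕-congʳ ⊕-comm ∙ ⊕-assoc

  ·-resp-≈ : ∀ {α β t} → α ≈ β → α · t ≡ᵈ β · t
  ·-resp-≈ e = ≡-· e ≡-refl

  ·-split : ∀ {γ α β t} → γ ≈ α + β → γ · t ≡ᵈ α · t ⊕ β · t
  ·-split e = ·-resp-≈ e ∙ ·-distʳ

  ·-zeroʳ : ∀ α → α · 𝟎 ≡ᵈ 𝟎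
  ·-zeroʳ α = begin
    α · 𝟎                             ≈⟨ ≡-sym ⊕-identityʳ ⟩
    α · 𝟎 ⊕ 𝟎                         ≈⟨ ⊕-congˡ cancel ∙ ≡-sym ⊕-assoc ⟩
    (α · 𝟎 ⊕ α · 𝟎) ⊕ (- α) · 𝟎      ≈⟨ ⊕-congʳ (≡-sym ·-distˡ ∙ ≡-· ≈-refl ⊕-unit) ⟩
    α · 𝟎 ⊕ (- α) · 𝟎                 ≈⟨ ≡-sym cancel ⟩
    𝟎                                 ∎
    where
      open ≡ᵈ-Reasoning
      cancel : 𝟎 ≡ᵈ α · 𝟎 ⊕ (- α) · 𝟎
      cancel = begin
        𝟎                   ≈⟨ ≡-sym ·-one ⟩
        1# · 𝟎              ≈⟨ ·-split (≈-sym (+-identityʳ 1#)) ⟩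
        1# · 𝟎 ⊕ 0# · 𝟎     ≈⟨ ⊕-congʳ ·-one ∙ ⊕-unit ⟩
        0# · 𝟎              ≈⟨ ·-split (≈-sym (-‿inverseʳ α)) ⟩
        α · 𝟎 ⊕ (- α) · 𝟎   ∎

  Monomial : Set c
  Monomial = Scalar × Tm

  ⟦_⟧ : List Monomial → Dist
  ⟦ [] ⟧          = 𝟎
  ⟦ (γ , s) ∷ L ⟧ = γ · ⌜ s ⌝ ⊕ ⟦ L ⟧

  scale : Scalar → List Monomial → List Monomial
  scale α = map (map₁ (α *_))

  flatten : Dist → List Monomial
  flatten 𝟎       = []
  flatten ⌜ s ⌝   = [ (1# , s) ]
  flatten (s ⊕ t) = flatten s ++ flatten t
  flatten (α · t) = scale α (flatten t)

  ⟦⟧-++ : ∀ A B → ⟦ A ++ B ⟧ ≡ᵈ ⟦ A ⟧ ⊕ ⟦ B ⟧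
  ⟦⟧-++ []      B = ≡-sym ⊕-unit
  ⟦⟧-++ (m ∷ A) B = ⊕-congˡ (⟦⟧-++ A B) ∙ ≡-sym ⊕-assoc

  ⟦⟧-scale : ∀ α A → ⟦ scale α A ⟧ ≡ᵈ α · ⟦ A ⟧
  ⟦⟧-scale α []      = ≡-sym (·-zeroʳ α)
  ⟦⟧-scale α (m ∷ A) = ≡-⊕ (≡-sym ·-assoc) (⟦⟧-scale α A) ∙ ≡-sym ·-distˡ

  flatten-sound : ∀ t → t ≡ᵈ ⟦ flatten t ⟧
  flatten-sound 𝟎       = ≡-refl
  flatten-sound ⌜ s ⌝   = ≡-sym (⊕-identityʳ ∙ ·-one)
  flatten-sound (s ⊕ t) = ≡-⊕ (flatten-sound s) (flatten-sound t) ∙ ≡-sym (⟦⟧-++ (flatten s) (flatten t))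
  flatten-sound (α · t) = ≡-· ≈-refl (flatten-sound t) ∙ ≡-sym (⟦⟧-scale α (flatten t))

  data Move : List Monomial → List Monomial → Set (c ⊔ ℓ) where
    swap    : ∀ {m n L} → Move (m ∷ n ∷ L) (n ∷ m ∷ L)
    rescale : ∀ {γ δ s L} → γ ≈ δ → Move ((γ , s) ∷ L) ((δ , s) ∷ L)
    split   : ∀ {γ δ s L} → Move ((γ + δ , s) ∷ L) ((γ , s) ∷ (δ , s) ∷ L)
    merge   : ∀ {γ δ s L} → Move ((γ , s) ∷ (δ , s) ∷ L) ((γ + δ , s) ∷ L)

  infix 4 _⇝_ _⇝*_
  data _⇝_ : List Monomial → List Monomial → Set (c ⊔ ℓ) where
    here  : ∀ {A B} → Move A B → A ⇝ B
    there : ∀ {m A B} → A ⇝ B → m ∷ A ⇝ m ∷ B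

  _⇝*_ : List Monomial → List Monomial → Set (c ⊔ ℓ)
  _⇝*_ = Star _⇝_

  ≡⇒⇝* : ∀ {A B} → A ≡ B → A ⇝* B
  ≡⇒⇝* refl = ε

  Move-sym : ∀ {A B} → Move A B → Move B A
  Move-sym swap        = swap
  Move-sym (rescale e) = rescale (≈-sym e)
  Move-sym split       = merge
  Move-sym merge       = split

  ⇝-sym : ∀ {A B} → A ⇝ B → B ⇝ A
  ⇝-sym (here m)  = here (Move-sym m)
  ⇝-sym (there s) = there (⇝-sym s)

  ⇝-++ˡ : ∀ C {A B} → A ⇝ B → C ++ A ⇝ C ++ B
  ⇝-++ˡ []      s = s
  ⇝-++ˡ (m ∷ C) s = there (⇝-++ˡ C s)

  ⇝*-++ˡ : ∀ C {A B} → A ⇝* B → C ++ A ⇝* C ++ B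
  ⇝*-++ˡ C = gmap (C ++_) (⇝-++ˡ C)

  Move-++ʳ : ∀ D {A B} → Move A B → Move (A ++ D) (B ++ D)
  Move-++ʳ D swap        = swap
  Move-++ʳ D (rescale e) = rescale e
  Move-++ʳ D split       = split
  Move-++ʳ D merge       = merge

  ⇝-++ʳ : ∀ D {A B} → A ⇝ B → A ++ D ⇝ B ++ D
  ⇝-++ʳ D (here m)  = here (Move-++ʳ D m)
  ⇝-++ʳ D (there s) = there (⇝-++ʳ D s)

  ⇝*-++ʳ : ∀ D {A B} → A ⇝* B → A ++ D ⇝* B ++ D
  ⇝*-++ʳ D = gmap (_++ D) (⇝-++ʳ D)

  Move-scale : ∀ α {A B} → Move A B → scale α A ⇝* scale α B
  Move-scale α swap        = here swap ◅ ε
  Move-scale α (rescale e) = here (rescale (*-congˡ e)) ◅ ε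
  Move-scale α split       = here (rescale (distribˡ α _ _)) ◅ here split ◅ ε
  Move-scale α merge       = here merge ◅ here (rescale (≈-sym (distribˡ α _ _))) ◅ ε

  ⇝-scale : ∀ α {A B} → A ⇝ B → scale α A ⇝* scale α B
  ⇝-scale α (here m)      = Move-scale α m
  ⇝-scale α (there {m} s) = ⇝*-++ˡ [ map₁ (α *_) m ] (⇝-scale α s)

  ⇝*-scale : ∀ α {A B} → A ⇝* B → scale α A ⇝* scale α B
  ⇝*-scale α = kleisliStar (scale α) (⇝-scale α)

  ⇝*-rotate : ∀ m B D → m ∷ B ++ D ⇝* B ++ m ∷ D
  ⇝*-rotate m []      D = ε
  ⇝*-rotate m (n ∷ B) D = here swap ◅ ⇝*-++ˡ [ n ] (⇝*-rotate m B D)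

  ⇝*-++-comm : ∀ A B → A ++ B ⇝* B ++ A
  ⇝*-++-comm []      B = ≡⇒⇝* (sym (++-identityʳ B))
  ⇝*-++-comm (m ∷ A) B = ⇝*-++ˡ [ m ] (⇝*-++-comm A B) ◅◅ ⇝*-rotate m B A

  ⇝*-rescale : ∀ {f g : Scalar → Scalar} → (∀ γ → f γ ≈ g γ) → ∀ L → map (map₁ f) L ⇝* map (map₁ g) L
  ⇝*-rescale f≈g []      = ε
  ⇝*-rescale f≈g (m ∷ L) = here (rescale (f≈g (proj₁ m))) ◅ ⇝*-++ˡ [ _ ] (⇝*-rescale f≈g L)

  ⇝*-scale-+ : ∀ α β L → scale (α + β) L ⇝* scale α L ++ scale β L
  ⇝*-scale-+ α β []            = ε
  ⇝*-scale-+ α β ((γ , s) ∷ L) =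
    here (rescale (distribʳ γ α β)) ◅ here split ◅
    ⇝*-++ˡ ((α * γ , s) ∷ (β * γ , s) ∷ []) (⇝*-scale-+ α β L) ◅◅
    ⇝*-++ˡ [ (α * γ , s) ] (⇝*-rotate (β * γ , s) (scale α L) (scale β L))

  ≡ᵈ⇒⇝* : ∀ {s t} → s ≡ᵈ t → flatten s ⇝* flatten t
  ≡ᵈ⇒⇝* ≡-refl                      = ε
  ≡ᵈ⇒⇝* (≡-sym e)                   = reverse ⇝-sym (≡ᵈ⇒⇝* e)
  ≡ᵈ⇒⇝* (≡-trans e e')              = ≡ᵈ⇒⇝* e ◅◅ ≡ᵈ⇒⇝* e'
  ≡ᵈ⇒⇝* (≡-⊕ {s' = s'} {t} e e')    = ⇝*-++ʳ (flatten t) (≡ᵈ⇒⇝* e) ◅◅ ⇝*-++ˡ (flatten s') (≡ᵈ⇒⇝* e')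
  ≡ᵈ⇒⇝* (≡-· {α} {t = t} α≈β e)     = ⇝*-scale α (≡ᵈ⇒⇝* e) ◅◅ ⇝*-rescale (λ _ → *-congʳ α≈β) (flatten t)
  ≡ᵈ⇒⇝* (⊕-assoc {s} {t} {u})       = ≡⇒⇝* (++-assoc (flatten s) (flatten t) (flatten u))
  ≡ᵈ⇒⇝* (⊕-comm {s} {t})            = ⇝*-++-comm (flatten s) (flatten t)
  ≡ᵈ⇒⇝* ⊕-unit                      = ε
  ≡ᵈ⇒⇝* (·-one {t})                 = ⇝*-rescale *-identityˡ (flatten t) ◅◅ ≡⇒⇝* (map-id (flatten t))
  ≡ᵈ⇒⇝* (·-assoc {α} {β} {t})       =
    ≡⇒⇝* (sym (map-∘ (flatten t))) ◅◅ ⇝*-rescale (λ γ → ≈-sym (*-assoc α β γ)) (flatten t)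
  ≡ᵈ⇒⇝* (·-distʳ {α} {β} {t})       = ⇝*-scale-+ α β (flatten t)
  ≡ᵈ⇒⇝* (·-distˡ {α} {s} {t})       = ≡⇒⇝* (map-++ (map₁ (α *_)) (flatten s) (flatten t))

  -- Terms contain scalars, so their equality is undecidable: monomials are grouped by
  -- natural-number labels instead, a labelling τ giving the term of each label.
  Labelled : Set c
  Labelled = ℕ × Monomial

  strip : List Labelled → List Monomial
  strip = map proj₂

  ⟪_⟫ : List Labelled → Dist
  ⟪ A ⟫ = ⟦ strip A ⟧

  select : (ℕ → Bool) → List Labelled → List Labelled
  select P []      = []
  select P (a ∷ A) = if P (proj₁ a) then a ∷ select P A else select P A

  occurs : (ℕ → Bool) → List Labelled → Bool
  occurs P = any (P ∘ proj₁)

  weight : List Labelled → Scalar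
  weight []                  = 0#
  weight ((_ , (γ , _)) ∷ A) = γ + weight A

  relabel : (ℕ → ℕ) → List Labelled → List Labelled
  relabel ρ = map (map₁ ρ)

  is : ℕ → ℕ → Bool
  is k n = n ≡ᵇ k

  is-refl : ∀ k → is k k ≡ true
  is-refl k = dec-true (k ≟ k) refl

  is-≢ : ∀ {k n} → n ≢ k → is k n ≡ false
  is-≢ {k} {n} = dec-false (n ≟ k)

  is-sound : ∀ k n → is k n ≡ true → n ≡ k
  is-sound k n e = ≡ᵇ⇒≡ n k (Equivalence.from T-≡ e)

  Typed : (ℕ → Tm) → List Labelled → Set c
  Typed τ = All (λ a → proj₂ (proj₂ a) ≡ τ (proj₁ a))

  Homogeneous : Tm → List Labelled → Set c
  Homogeneous s = All (λ a → proj₂ (proj₂ a) ≡ s)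

  without : ℕ → List Labelled → List Labelled
  without k = select (not ∘ is k)

  select-is-head : ∀ k {m} A → select (is k) ((k , m) ∷ A) ≡ (k , m) ∷ select (is k) A
  select-is-head k A rewrite is-refl k = refl

  occurs-is-head : ∀ k {m} A → occurs (is k) ((k , m) ∷ A) ≡ true
  occurs-is-head k A rewrite is-refl k = refl

  without-head : ∀ k {m} A → without k ((k , m) ∷ A) ≡ without k A
  without-head k A rewrite is-refl k = refl

  select-is-other : ∀ {k n m} A → n ≢ k → select (is k) ((n , m) ∷ A) ≡ select (is k) A
  select-is-other A n≢k rewrite is-≢ n≢k = refl

  without-other : ∀ {k n m} A → n ≢ k → without k ((n , m) ∷ A) ≡ (n , m) ∷ without k A
  without-other A n≢k rewrite is-≢ n≢k = refl

  occurs⇒select-∷ : ∀ P A → occurs P A ≡ true → ∃₂ λ a A' → select P A ≡ a ∷ A'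
  occurs⇒select-∷ P ((k , m) ∷ A) h with P k
  ... | true  = (k , m) , select P A , refl
  ... | false = occurs⇒select-∷ P A h

  occurs-select : ∀ P Q A → occurs P (select Q A) ≡ occurs (λ n → Q n ∧ P n) A
  occurs-select P Q []            = refl
  occurs-select P Q ((k , m) ∷ A) with Q k
  ... | true  = cong (P k ∨_) (occurs-select P Q A)
  ... | false = occurs-select P Q A

  select-select : ∀ P Q A → select P (select Q A) ≡ select (λ n → Q n ∧ P n) A
  select-select P Q []            = refl
  select-select P Q ((k , m) ∷ A) with Q k
  ... | false = select-select P Q A
  ... | true with P k
  ...   | true  = cong ((k , m) ∷_) (select-select P Q A)
  ...   | false = select-select P Q A

  occurs-relabel : ∀ ρ P A → occurs P (relabel ρ A) ≡ occurs (P ∘ ρ) A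
  occurs-relabel ρ P []            = refl
  occurs-relabel ρ P ((k , m) ∷ A) = cong (P (ρ k) ∨_) (occurs-relabel ρ P A)

  select-relabel : ∀ ρ P A → select P (relabel ρ A) ≡ relabel ρ (select (P ∘ ρ) A)
  select-relabel ρ P []            = refl
  select-relabel ρ P ((k , m) ∷ A) with P (ρ k)
  ... | true  = cong ((ρ k , m) ∷_) (select-relabel ρ P A)
  ... | false = select-relabel ρ P A

  weight-relabel : ∀ ρ A → weight (relabel ρ A) ≡ weight A
  weight-relabel ρ []      = refl
  weight-relabel ρ (a ∷ A) = cong (proj₁ (proj₂ a) +_) (weight-relabel ρ A)

  strip-relabel : ∀ ρ A → strip (relabel ρ A) ≡ strip A
  strip-relabel ρ A = sym (map-∘ A)

  Typed-relabel : ∀ {τ τ'} ρ → (∀ n → τ' (ρ n) ≡ τ n) → ∀ {A} → Typed τ A → Typed τ' (relabel ρ A)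
  Typed-relabel ρ τρ []       = []
  Typed-relabel ρ τρ {(k , _) ∷ _} (p ∷ ps) = trans p (sym (τρ k)) ∷ Typed-relabel ρ τρ ps

  Typed-select : ∀ {τ} Q {A} → Typed τ A → Typed τ (select Q A)
  Typed-select Q []       = []
  Typed-select Q {a ∷ _} (p ∷ ps) with Q (proj₁ a)
  ... | true  = p ∷ Typed-select Q ps
  ... | false = Typed-select Q ps

  select-is-homogeneous : ∀ {τ} k A → Typed τ A → Homogeneous (τ k) (select (is k) A)
  select-is-homogeneous k []            []       = []
  select-is-homogeneous k ((n , m) ∷ A) (p ∷ ps) with n ≡ᵇ k in n≡ᵇk
  ... | true  = trans p (cong _ (is-sound k n n≡ᵇk)) ∷ select-is-homogeneous k A ps
  ... | false = select-is-homogeneous k A ps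

  ⟪⟫-partition : ∀ P A → ⟪ A ⟫ ≡ᵈ ⟪ select P A ⟫ ⊕ ⟪ select (not ∘ P) A ⟫
  ⟪⟫-partition P []            = ≡-sym ⊕-unit
  ⟪⟫-partition P ((k , m) ∷ A) with P k
  ... | true  = ⊕-congˡ (⟪⟫-partition P A) ∙ ≡-sym ⊕-assoc
  ... | false = ⊕-congˡ (⟪⟫-partition P A) ∙ ⊕-lcomm

  ⟪⟫-collect : ∀ {s} β A → Homogeneous s A → β · ⌜ s ⌝ ⊕ ⟪ A ⟫ ≡ᵈ (β + weight A) · ⌜ s ⌝
  ⟪⟫-collect β []            []         = ⊕-identityʳ ∙ ·-resp-≈ (≈-sym (+-identityʳ β))
  ⟪⟫-collect β ((k , (γ , s)) ∷ A) (refl ∷ h) =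
    ≡-sym ⊕-assoc ∙ ⊕-congʳ (≡-sym ·-distʳ) ∙ ⟪⟫-collect (β + γ) A h ∙ ·-resp-≈ (+-assoc β γ (weight A))

  ⟪⟫-homogeneous : ∀ {s A} → Homogeneous s A → ∃₂ (λ a A' → A ≡ a ∷ A') → ⟪ A ⟫ ≡ᵈ weight A · ⌜ s ⌝
  ⟪⟫-homogeneous (refl ∷ h) (_ , A , refl) = ⟪⟫-collect _ A h

  ⟪⟫-group : ∀ {τ} k A → Typed τ A → occurs (is k) A ≡ true
            → ⟪ select (is k) A ⟫ ≡ᵈ weight (select (is k) A) · ⌜ τ k ⌝
  ⟪⟫-group k A τA h = ⟪⟫-homogeneous (select-is-homogeneous k A τA) (occurs⇒select-∷ (is k) A h)

  record Similar (A B : List Labelled) : Set (c ⊔ ℓ) where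
    field
      -- 0 · t ≢ 𝟎, so equal weights alone do not make a label's groups ≡ᵈ.
      occurs-≡ : ∀ P → occurs P A ≡ occurs P B
      weight-≈ : ∀ P → weight (select P A) ≈ weight (select P B)
  open Similar

  Similar-refl : ∀ {A} → Similar A A
  occurs-≡ Similar-refl P = refl
  weight-≈ Similar-refl P = ≈-refl

  Similar-sym : ∀ {A B} → Similar A B → Similar B A
  occurs-≡ (Similar-sym S) P = sym (occurs-≡ S P)
  weight-≈ (Similar-sym S) P = ≈-sym (weight-≈ S P)

  Similar-trans : ∀ {A B C} → Similar A B → Similar B C → Similar A C
  occurs-≡ (Similar-trans S T) P = trans (occurs-≡ S P) (occurs-≡ T P)
  weight-≈ (Similar-trans S T) P = ≈-trans (weight-≈ S P) (weight-≈ T P)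

  Similar-∷ : ∀ a {A B} → Similar A B → Similar (a ∷ A) (a ∷ B)
  occurs-≡ (Similar-∷ a S) P = cong (P (proj₁ a) ∨_) (occurs-≡ S P)
  weight-≈ (Similar-∷ a S) P with P (proj₁ a)
  ... | true  = +-congˡ (weight-≈ S P)
  ... | false = weight-≈ S P

  Similar-swap : ∀ a b A → Similar (a ∷ b ∷ A) (b ∷ a ∷ A)
  occurs-≡ (Similar-swap a b A) P with P (proj₁ a) | P (proj₁ b)
  ... | true  | true  = refl
  ... | true  | false = refl
  ... | false | true  = refl
  ... | false | false = refl
  weight-≈ (Similar-swap a b A) P with P (proj₁ a) | P (proj₁ b)
  ... | true  | true  = x∙yz≈y∙xz _ _ _
  ... | true  | false = ≈-refl
  ... | false | true  = ≈-refl
  ... | false | false = ≈-refl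

  Similar-rescale : ∀ {k γ δ s} A → γ ≈ δ → Similar ((k , (γ , s)) ∷ A) ((k , (δ , s)) ∷ A)
  occurs-≡ (Similar-rescale A γ≈δ) P = refl
  weight-≈ (Similar-rescale {k} A γ≈δ) P with P k
  ... | true  = +-congʳ γ≈δ
  ... | false = ≈-refl

  Similar-split : ∀ {k γ δ s} A → Similar ((k , (γ + δ , s)) ∷ A) ((k , (γ , s)) ∷ (k , (δ , s)) ∷ A)
  occurs-≡ (Similar-split {k} A) P with P k
  ... | true  = refl
  ... | false = refl
  weight-≈ (Similar-split {k} {γ} {δ} A) P with P k
  ... | true  = +-assoc γ δ _
  ... | false = ≈-refl

  Similar-select : ∀ Q {A B} → Similar A B → Similar (select Q A) (select Q B)
  occurs-≡ (Similar-select Q {A} {B} S) P =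
    trans (occurs-select P Q A) (trans (occurs-≡ S _) (sym (occurs-select P Q B)))
  weight-≈ (Similar-select Q {A} {B} S) P =
    ≈-trans (≈-reflexive (cong weight (select-select P Q A)))
      (≈-trans (weight-≈ S _) (≈-reflexive (cong weight (sym (select-select P Q B)))))

  Similar-relabel : ∀ ρ {A B} → Similar A B → Similar (relabel ρ A) (relabel ρ B)
  occurs-≡ (Similar-relabel ρ {A} {B} S) P =
    trans (occurs-relabel ρ P A) (trans (occurs-≡ S (P ∘ ρ)) (sym (occurs-relabel ρ P B)))
  weight-≈ (Similar-relabel ρ {A} {B} S) P =
    ≈-trans (≈-reflexive (weight-select-relabel A))
      (≈-trans (weight-≈ S (P ∘ ρ)) (≈-reflexive (sym (weight-select-relabel B))))
    where
      weight-select-relabel : ∀ X → weight (select P (relabel ρ X)) ≡ weight (select (P ∘ ρ) X)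
      weight-select-relabel X =
        trans (cong weight (select-relabel ρ P X)) (weight-relabel ρ (select (P ∘ ρ) X))

  record Balanced (τ : ℕ → Tm) (A B : List Labelled) : Set (c ⊔ ℓ) where
    field
      typedˡ  : Typed τ A
      typedʳ  : Typed τ B
      similar : Similar A B

  Balanced-select : ∀ {τ} Q {A B} → Balanced τ A B → Balanced τ (select Q A) (select Q B)
  Balanced-select Q bal = record
    { typedˡ  = Typed-select Q typedˡ
    ; typedʳ  = Typed-select Q typedʳ
    ; similar = Similar-select Q similar
    }
    where open Balanced bal

  Balanced-sym : ∀ {τ A B} → Balanced τ A B → Balanced τ B A
  Balanced-sym bal = record { typedˡ = typedʳ ; typedʳ = typedˡ ; similar = Similar-sym similar }
    where open Balanced bal

  record Surplus (u : Tm) (γ : Scalar) (A B : List Labelled) : Set (c ⊔ ℓ) where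
    constructor surplus
    field
      grouped : ⟪ B ⟫ ≡ᵈ weight B · ⌜ u ⌝
      excess  : weight B ≈ γ + weight A

  head-group : ∀ {τ k γ s A B} → Balanced τ ((k , (γ , s)) ∷ A) B
             → Surplus (τ k) γ (select (is k) A) (select (is k) B)
  head-group {k = k} {γ} {s} {A} {B} bal = surplus
    (⟪⟫-group k B typedʳ (trans (sym (occurs-≡ similar (is k))) (occurs-is-head k {γ , s} A)))
    (≈-trans (≈-sym (weight-≈ similar (is k))) (≈-reflexive (cong weight (select-is-head k {γ , s} A))))
    where open Balanced bal

  length-select : ∀ P A → length (select P A) ≤ length A
  length-select P []      = z≤n
  length-select P (a ∷ A) with P (proj₁ a)
  ... | true  = s≤s (length-select P A)
  ... | false = m≤n⇒m≤1+n (length-select P A)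

  ⟪⟫-resp-Balanced : ∀ {τ A B} → Balanced τ A B → ⟪ A ⟫ ≡ᵈ ⟪ B ⟫
  ⟪⟫-resp-Balanced {A = A} = go (length A) ≤-refl
    where
      go : ∀ {τ} n {A B} → length A ≤ n → Balanced τ A B → ⟪ A ⟫ ≡ᵈ ⟪ B ⟫
      go n       {[]}    {[]}    _ _ = ≡-refl
      go n       {[]}    {_ ∷ _} _ bal with () ← occurs-≡ (Balanced.similar bal) (λ _ → true)
      go (suc n) {(k , m) ∷ A} {B} (s≤s len) bal = begin
        ⟪ A⁺ ⟫                                               ≈⟨ ⟪⟫-partition (is k) A⁺ ⟩
        ⟪ select (is k) A⁺ ⟫ ⊕ ⟪ without k A⁺ ⟫             ≈⟨ ≡-⊕ group rest ⟩
        ⟪ select (is k) B ⟫ ⊕ ⟪ without k B ⟫               ≈⟨ ≡-sym (⟪⟫-partition (is k) B) ⟩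
        ⟪ B ⟫                                                ∎
        where
          open ≡ᵈ-Reasoning
          open Balanced bal
          A⁺ = (k , m) ∷ A
          k∈A⁺ : occurs (is k) A⁺ ≡ true
          k∈A⁺ rewrite is-refl k = refl
          group : ⟪ select (is k) A⁺ ⟫ ≡ᵈ ⟪ select (is k) B ⟫
          group = ⟪⟫-group k A⁺ typedˡ k∈A⁺ ∙ ·-resp-≈ (weight-≈ similar (is k))
                ∙ ≡-sym (⟪⟫-group k B typedʳ (trans (sym (occurs-≡ similar (is k))) k∈A⁺))
          shorter : length (without k A⁺) ≤ n
          shorter rewrite without-head k {m} A = ≤-trans (length-select _ A) len
          rest : ⟪ without k A⁺ ⟫ ≡ᵈ ⟪ without k B ⟫
          rest = go n shorter (Balanced-select (not ∘ is k) bal)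

  redirect : ℕ → ℕ → ℕ → ℕ
  redirect k k' n = if is k n then k' else n

  redirect-source : ∀ k k' → redirect k k' k ≡ k'
  redirect-source k k' rewrite is-refl k = refl

  redirect-target : ∀ k k' → redirect k k' k' ≡ k'
  redirect-target k k' with is k k'
  ... | true  = refl
  ... | false = refl

  redirect-typed : ∀ {τ : ℕ → Tm} k k' → τ k' ≡ τ k → ∀ n → τ (redirect k k' n) ≡ τ n
  redirect-typed k k' τk'≡τk n with is k n in n≡ᵇk
  ... | true  = trans τk'≡τk (cong _ (sym (is-sound k n n≡ᵇk)))
  ... | false = refl

  record LiftedStep (τ : ℕ → Tm) (A : List Labelled) (M : List Monomial) : Set (c ⊔ ℓ) where
    field
      ρ       : ℕ → ℕ
      ρ-typed : ∀ n → τ (ρ n) ≡ τ n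
      target  : List Labelled
      strip-target : strip target ≡ M
      typed-target : Typed τ target
      similar-target : Similar (relabel ρ A) target

  keeping-labels : ∀ {τ A} B → Typed τ B → Similar A B → LiftedStep τ A (strip B)
  keeping-labels {A = A} B τB A∼B = record
    { ρ = λ n → n ; ρ-typed = λ _ → refl ; target = B ; strip-target = refl ; typed-target = τB
    ; similar-target = subst (λ X → Similar X B) (sym (map-id A)) A∼B }

  lift-Move : ∀ {τ} A {M} → Typed τ A → Move (strip A) M → LiftedStep τ A M
  lift-Move (a ∷ b ∷ A) (p ∷ q ∷ ps) swap = keeping-labels (b ∷ a ∷ A) (q ∷ p ∷ ps) (Similar-swap a b A)
  lift-Move ((k , _) ∷ A) (p ∷ ps) (rescale {δ = δ} {s} γ≈δ) =
    keeping-labels ((k , (δ , s)) ∷ A) (p ∷ ps) (Similar-rescale A γ≈δ)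
  lift-Move ((k , _) ∷ A) (p ∷ ps) (split {γ} {δ} {s}) =
    keeping-labels ((k , (γ , s)) ∷ (k , (δ , s)) ∷ A) (p ∷ p ∷ ps) (Similar-split A)
  lift-Move {τ} ((k , (γ , s)) ∷ (k' , (δ , _)) ∷ A) (p ∷ q ∷ ps) merge = record
    { ρ = ρ ; ρ-typed = ρ-typed ; target = target
    ; strip-target = cong ((γ + δ , s) ∷_) (strip-relabel ρ A)
    ; typed-target = p ∷ Typed-relabel ρ ρ-typed ps
    ; similar-target = subst₂ (λ i j → Similar ((i , (γ , s)) ∷ (j , (δ , s)) ∷ relabel ρ A) target)
        (sym (redirect-target k' k)) (sym (redirect-source k' k)) (Similar-sym (Similar-split (relabel ρ A)))
    }
    where
      ρ = redirect k' k
      target = (k , (γ + δ , s)) ∷ relabel ρ A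
      ρ-typed : ∀ n → τ (ρ n) ≡ τ n
      ρ-typed = redirect-typed k' k (trans (sym p) q)

  lift-⇝ : ∀ {τ} A {M} → Typed τ A → strip A ⇝ M → LiftedStep τ A M
  lift-⇝ []      τA (here m) = lift-Move [] τA m
  lift-⇝ (a ∷ A) τA (here m) = lift-Move (a ∷ A) τA m
  lift-⇝ {τ} (a ∷ A) (p ∷ ps) (there s) = record
    { ρ = ρ ; ρ-typed = ρ-typed ; target = map₁ ρ a ∷ target
    ; strip-target = cong (proj₂ a ∷_) strip-target
    ; typed-target = trans p (sym (ρ-typed (proj₁ a))) ∷ typed-target
    ; similar-target = Similar-∷ (map₁ ρ a) similar-target
    }
    where open LiftedStep (lift-⇝ A ps s)

  record BalancedLabelling (A B : List Monomial) : Set (c ⊔ ℓ) where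
    constructor labelling
    field
      τ               : ℕ → Tm
      labelledˡ       : List Labelled
      labelledʳ       : List Labelled
      strip-labelledˡ : strip labelledˡ ≡ A
      strip-labelledʳ : strip labelledʳ ≡ B
      balanced        : Balanced τ labelledˡ labelledʳ

  enumerate : List Monomial → List Labelled
  enumerate []      = []
  enumerate (m ∷ L) = (0 , m) ∷ relabel suc (enumerate L)

  term-at : List Monomial → ℕ → Tm
  term-at []      _       = val unit  -- never reached from a label of enumerate L
  term-at (m ∷ L) zero    = proj₂ m
  term-at (m ∷ L) (suc k) = term-at L k

  Typed-enumerate : ∀ L → Typed (term-at L) (enumerate L)
  Typed-enumerate []      = []
  Typed-enumerate (m ∷ L) = refl ∷ Typed-relabel suc (λ _ → refl) (Typed-enumerate L)

  strip-enumerate : ∀ L → strip (enumerate L) ≡ L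
  strip-enumerate []      = refl
  strip-enumerate (m ∷ L) = cong (m ∷_) (trans (strip-relabel suc (enumerate L)) (strip-enumerate L))

  labelling-refl : ∀ {L} → BalancedLabelling L L
  labelling-refl {L} =
    labelling (term-at L) (enumerate L) (enumerate L) (strip-enumerate L) (strip-enumerate L)
      (record { typedˡ = Typed-enumerate L ; typedʳ = Typed-enumerate L ; similar = Similar-refl })

  labelling-step : ∀ {A B C} → BalancedLabelling A B → B ⇝ C → BalancedLabelling A C
  labelling-step (labelling τ AA BB refl refl bal) s =
    labelling τ (relabel ρ AA) target (strip-relabel ρ AA) strip-target
      (record { typedˡ = Typed-relabel ρ ρ-typed typedˡ ; typedʳ = typed-target
              ; similar = Similar-trans (Similar-relabel ρ similar) similar-target })
    where
      open Balanced bal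
      open LiftedStep (lift-⇝ BB typedʳ s)

  ⇝*⇒labelling : ∀ {A B} → A ⇝* B → BalancedLabelling A B
  ⇝*⇒labelling = foldl BalancedLabelling labelling-step labelling-refl

  ▷-deterministic : ∀ {s a b} → s ▷ a → s ▷ b → a ≡ b
  ▷-deterministic β-lam       β-lam        = refl
  ▷-deterministic β-lam       (ξ-appR ())
  ▷-deterministic β-lam       (ξ-appL ())
  ▷-deterministic β-seq       β-seq        = refl
  ▷-deterministic β-seq       (ξ-seq ())
  ▷-deterministic β-let       β-let        = refl
  ▷-deterministic β-let       (ξ-let ())
  ▷-deterministic β-inl       β-inl        = refl
  ▷-deterministic β-inl       (ξ-match ())
  ▷-deterministic β-inr       β-inr        = refl
  ▷-deterministic β-inr       (ξ-match ())
  ▷-deterministic (ξ-appR ()) β-lam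
  ▷-deterministic (ξ-appR r)  (ξ-appR r')  = cong (lin _) (▷-deterministic r r')
  ▷-deterministic (ξ-appR ()) (ξ-appL _)
  ▷-deterministic (ξ-appL ()) β-lam
  ▷-deterministic (ξ-appL _)  (ξ-appR ())
  ▷-deterministic (ξ-appL r)  (ξ-appL r')  = cong (lin _) (▷-deterministic r r')
  ▷-deterministic (ξ-seq ())  β-seq
  ▷-deterministic (ξ-seq r)   (ξ-seq r')   = cong (lin _) (▷-deterministic r r')
  ▷-deterministic (ξ-let ())  β-let
  ▷-deterministic (ξ-let r)   (ξ-let r')   = cong (lin _) (▷-deterministic r r')
  ▷-deterministic (ξ-match ()) β-inl
  ▷-deterministic (ξ-match ()) β-inr
  ▷-deterministic (ξ-match r) (ξ-match r') = cong (lin _) (▷-deterministic r r')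

  Joinable : Dist → Dist → Set (c ⊔ ℓ)
  Joinable t₁ t₂ = (t₁ ≡ᵈ t₂) ⊎ ((t₁ ≻ t₂) ⊎ (t₂ ≻ t₁)) ⊎ (∃[ t'' ] ((t₁ ≻ t'') × (t₂ ≻ t'')))

  ≻-intro : ∀ {t t' γ s s' r} → t ≡ᵈ γ · ⌜ s ⌝ ⊕ r → s ▷ s' → t' ≡ᵈ γ · s' ⊕ r → t ≻ t'
  ≻-intro e s▷s' e' = _ , _ , _ , _ , e , e' , s▷s'

  ≻-respʳ : ∀ {t u u'} → t ≻ u → u ≡ᵈ u' → t ≻ u'
  ≻-respʳ (α , s , s' , r , e , e' , s▷s') u≡u' = α , s , s' , r , e , (≡-sym u≡u' ∙ e') , s▷s'

  infix 4 _≻⁼_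
  _≻⁼_ : Dist → Dist → Set (c ⊔ ℓ)
  t ≻⁼ u = t ≡ᵈ u ⊎ t ≻ u

  join : ∀ {t₁ t₂ T₁ T₂} → t₁ ≻⁼ T₁ → t₂ ≻⁼ T₂ → T₁ ≡ᵈ T₂ → Joinable t₁ t₂
  join (inj₁ e₁) (inj₁ e₂) T₁≡T₂ = inj₁ (e₁ ∙ T₁≡T₂ ∙ ≡-sym e₂)
  join (inj₁ e₁) (inj₂ r₂) T₁≡T₂ = inj₂ (inj₁ (inj₂ (≻-respʳ r₂ (≡-sym T₁≡T₂ ∙ ≡-sym e₁))))
  join (inj₂ r₁) (inj₁ e₂) T₁≡T₂ = inj₂ (inj₁ (inj₁ (≻-respʳ r₁ (T₁≡T₂ ∙ ≡-sym e₂))))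
  join (inj₂ r₁) (inj₂ r₂) T₁≡T₂ = inj₂ (inj₂ (_ , r₁ , ≻-respʳ r₂ (≡-sym T₁≡T₂)))

  ≻⁼-reduce-group : ∀ {t α s s' D} A → Homogeneous s A → s ▷ s'
                  → t ≡ᵈ α · s' ⊕ (⟪ A ⟫ ⊕ D) → t ≻⁼ (α + weight A) · s' ⊕ D
  ≻⁼-reduce-group []      _ _     e = inj₁ (e ∙ ⊕-congˡ ⊕-unit ∙ ⊕-congʳ (·-resp-≈ (≈-sym (+-identityʳ _))))
  ≻⁼-reduce-group {α = α} (a ∷ A) h s▷s' e =
    inj₂ (≻-intro (e ∙ ⊕-lcomm ∙ ⊕-congʳ (⟪⟫-homogeneous h (a , A , refl))) s▷s'
                  (⊕-congʳ (·-split (+-comm α _)) ∙ ⊕-assoc))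

  ≻-absorb : ∀ {t α s' β u u' A B M D} → Homogeneous u A → Surplus u β A B → u ▷ u'
           → t ≡ᵈ α · s' ⊕ (⟪ B ⟫ ⊕ (⟪ M ⟫ ⊕ D))
           → t ≻ (β · u' ⊕ ⟪ A ⟫) ⊕ ((α · s' ⊕ ⟪ M ⟫) ⊕ D)
  ≻-absorb {t} {α} {s'} {β} {u} {A = A} {B} {M} {D} hA (surplus B-grouped B-excess) u▷u' e =
    ≻-intro t≡ u▷u' (⊕-assoc ∙ ⊕-congˡ (⊕-congˡ ⊕-assoc))
    where
      open ≡ᵈ-Reasoning
      X = α · s' ⊕ (⟪ M ⟫ ⊕ D)
      t≡ : t ≡ᵈ β · ⌜ u ⌝ ⊕ (⟪ A ⟫ ⊕ X)
      t≡ = begin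
        t                              ≈⟨ e ∙ ⊕-lcomm ⟩
        ⟪ B ⟫ ⊕ X                      ≈⟨ ⊕-congʳ (B-grouped ∙ ·-resp-≈ B-excess) ⟩
        (β + weight A) · ⌜ u ⌝ ⊕ X     ≈⟨ ⊕-congʳ (≡-sym (⟪⟫-collect β A hA)) ∙ ⊕-assoc ⟩
        β · ⌜ u ⌝ ⊕ (⟪ A ⟫ ⊕ X)        ∎

  join-same-label : ∀ {τ t₁ t₂ g α β s s' u u' RR QQ}
    → Balanced τ ((g , (α , s)) ∷ RR) ((g , (β , u)) ∷ QQ) → s ▷ s' → u ▷ u'
    → t₁ ≡ᵈ α · s' ⊕ ⟪ RR ⟫ → t₂ ≡ᵈ β · u' ⊕ ⟪ QQ ⟫ → Joinable t₁ t₂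
  join-same-label {τ} {t₁} {t₂} {g} {α} {β} {s} {s'} {u} {u'} {RR} {QQ} bal s▷s' u▷u' e₁ e₂ =
    join (≻⁼-reduce-group (select (is g) RR) (select-is-homogeneous g RR (All.tail typedˡ)) τg▷s'
           (e₁ ∙ ⊕-congˡ (⟪⟫-partition (is g) RR)))
         (≻⁼-reduce-group (select (is g) QQ) (select-is-homogeneous g QQ (All.tail typedʳ)) τg▷s'
           (e₂' ∙ ⊕-congˡ (⟪⟫-partition (is g) QQ)))
         (≡-⊕ (·-resp-≈ weights) rests)
    where
      open Balanced bal
      τg▷s' : τ g ▷ s'
      τg▷s' = subst (_▷ s') (All.head typedˡ) s▷s'
      e₂' : t₂ ≡ᵈ β · s' ⊕ ⟪ QQ ⟫
      u'≡s' : u' ≡ s'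
      u'≡s' = ▷-deterministic (subst (_▷ u') (All.head typedʳ) u▷u') τg▷s'
      e₂' = subst (λ x → t₂ ≡ᵈ β · x ⊕ ⟪ QQ ⟫) u'≡s' e₂
      weights : α + weight (select (is g) RR) ≈ β + weight (select (is g) QQ)
      weights = ≈-trans (≈-reflexive (cong weight (sym (select-is-head g {α , s} RR))))
        (≈-trans (weight-≈ similar (is g)) (≈-reflexive (cong weight (select-is-head g {β , u} QQ))))
      rests : ⟪ without g RR ⟫ ≡ᵈ ⟪ without g QQ ⟫
      rests = ⟪⟫-resp-Balanced
        (subst₂ (Balanced τ) (without-head g RR) (without-head g QQ) (Balanced-select (not ∘ is g) bal))

  join-distinct-labels : ∀ {τ t₁ t₂ g h α β s s' u u' RR QQ} → g ≢ h
    → Balanced τ ((g , (α , s)) ∷ RR) ((h , (β , u)) ∷ QQ) → s ▷ s' → u ▷ u'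
    → t₁ ≡ᵈ α · s' ⊕ ⟪ RR ⟫ → t₂ ≡ᵈ β · u' ⊕ ⟪ QQ ⟫ → Joinable t₁ t₂
  join-distinct-labels {τ} {t₁} {t₂} {g} {h} {α} {β} {s} {s'} {u} {u'} {RR} {QQ} g≢h bal s▷s' u▷u' e₁ e₂ =
    join (inj₂ (≻-absorb (select-is-homogeneous h QQ (All.tail typedʳ)) h-group τh▷u' e₁'))
         (inj₂ (≻-absorb (select-is-homogeneous g R' (All.tail (Balanced.typedˡ bal'))) g-group τg▷s' e₂'))
         (⊕-lcomm ∙ ⊕-congˡ (⊕-congˡ rests))
    where
      open Balanced bal
      R' = without h RR
      Q' = without h QQ
      τg▷s' : τ g ▷ s'
      τg▷s' = subst (_▷ s') (All.head typedˡ) s▷s'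
      τh▷u' : τ h ▷ u'
      τh▷u' = subst (_▷ u') (All.head typedʳ) u▷u'
      bal' : Balanced τ ((g , (α , s)) ∷ R') Q'
      bal' = subst₂ (Balanced τ) (without-other RR g≢h) (without-head h QQ) (Balanced-select (not ∘ is h) bal)
      h-group : Surplus (τ h) β (select (is h) QQ) (select (is h) RR)
      h-group = subst (Surplus (τ h) β (select (is h) QQ)) (select-is-other RR g≢h)
                  (head-group (Balanced-sym bal))
      g-group : Surplus (τ g) α (select (is g) R') (select (is g) Q')
      g-group = head-group bal'
      rests : ⟪ without g R' ⟫ ≡ᵈ ⟪ without g Q' ⟫
      rests = ⟪⟫-resp-Balanced
        (subst (λ X → Balanced τ X (without g Q')) (without-head g R') (Balanced-select (not ∘ is g) bal'))
      e₁' : t₁ ≡ᵈ α · s' ⊕ (⟪ select (is h) RR ⟫ ⊕ (⟪ select (is g) R' ⟫ ⊕ ⟪ without g R' ⟫))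
      e₁' = e₁ ∙ ⊕-congˡ (⟪⟫-partition (is h) RR ∙ ⊕-congˡ (⟪⟫-partition (is g) R'))
      e₂' : t₂ ≡ᵈ β · u' ⊕ (⟪ select (is g) Q' ⟫ ⊕ (⟪ select (is h) QQ ⟫ ⊕ ⟪ without g Q' ⟫))
      e₂' = e₂ ∙ ⊕-congˡ (⟪⟫-partition (is h) QQ ∙ ⊕-congˡ (⟪⟫-partition (is g) Q') ∙ ⊕-lcomm)

  strip-∷⁻ : ∀ {m L} A → strip A ≡ m ∷ L → ∃₂ λ k A' → A ≡ (k , m) ∷ A' × strip A' ≡ L
  strip-∷⁻ ((k , m) ∷ A) refl = k , A , refl , refl

  ≡ᵈ-flattened : ∀ {t γ x r A} → t ≡ᵈ γ · x ⊕ r → strip A ≡ flatten r → t ≡ᵈ (γ * 1#) · x ⊕ ⟪ A ⟫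
  ≡ᵈ-flattened {r = r} e strip-A =
    e ∙ ≡-⊕ (·-resp-≈ (≈-sym (*-identityʳ _)))
            (flatten-sound r ∙ Setoid.reflexive ≡ᵈ-setoid (cong ⟦_⟧ (sym strip-A)))

  weak-diamond : ∀ t t₁ t₂ → t ≻ t₁ → t ≻ t₂ → Joinable t₁ t₂
  weak-diamond t t₁ t₂ (α , s , s' , r , t≡αs+r , t₁≡αs'+r , s▷s') (β , u , u' , q , t≡βu+q , t₂≡βu'+q , u▷u')
    with labelling τ AA BB strip-AA strip-BB bal ← ⇝*⇒labelling (≡ᵈ⇒⇝* (≡-sym t≡αs+r ∙ t≡βu+q))
    with g , RR , refl , strip-RR ← strip-∷⁻ AA strip-AA
       | h , QQ , refl , strip-QQ ← strip-∷⁻ BB strip-BB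
    with g ≟ h
  ... | yes refl =
    join-same-label bal s▷s' u▷u' (≡ᵈ-flattened t₁≡αs'+r strip-RR) (≡ᵈ-flattened t₂≡βu'+q strip-QQ)
  ... | no g≢h   =
    join-distinct-labels g≢h bal s▷s' u▷u' (≡ᵈ-flattened t₁≡αs'+r strip-RR) (≡ᵈ-flattened t₂≡βu'+q strip-QQ)

lemma2 : ∀ {c ℓ} (R : CommutativeRing c ℓ) → let open Calculus R in
           ∀ (t t₁ t₂ : Dist) → t ≻ t₁ → t ≻ t₂ →
           (t₁ ≡ᵈ t₂) ⊎ ((t₁ ≻ t₂) ⊎ (t₂ ≻ t₁)) ⊎ (∃[ t'' ] ((t₁ ≻ t'') × (t₂ ≻ t'')))
lemma2 R = WeakDiamond.weak-diamond R
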